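{- Let $G$ be a complete multipartite graph with at least two parts, regarded as a graph of goods, and let $N=[n]$ be any finite set of $n\ge1$ agents with nonnegative additive utility functions $u_1,\dots,u_n$ on $V(G)$. Then there exists a $\frac14$-mms-allocation, i.e., a $(G,n)$-partition $(A_1,\dots,A_n)$ of $V(G)$ into bundles such that $u_i(A_i)\ge \frac14\,\mathsf{mms}^{(n)}(G,u_i)$ for every $i\in[n]$.
   Context: A graph is complete multipartite if its vertex set can be partitioned into (nonempty) parts such that two vertices are adjacent if and only if they lie in different parts. Goods are the vertices of $G$. Each agent $i$ has a utility function $u_i$ assigning a nonnegative real to each vertex, extended additively to sets: $u_i(X)=\sum_{v\in X}u_i(v)$, $u_i(\emptyset)=0$. A bundle is a set $X\subseteq V(G)$ inducing a connected subgraph of $G$ (the empty set is a bundle). A $(G,n)$-partition is a tuple $(P_1,\dots,P_n)$ of pairwise disjoint bundles with $\bigcup_j P_j=V(G)$; as an allocation, $P_i$ is given to agent $i$. The maximin share is $\mathsf{mms}^{(n)}(G,u)=\max_{(P_1,\dots,P_n)}\min_{j\in[n]}u(P_j)$, the maximum over all $(G,n)$-partitions.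
   Formalization: The utility functions $u_1,\dots,u_n$ take nonnegative rational values instead of nonnegative real values. -}

module Defs where

open import Data.Nat using (ℕ; zero; suc; _≤_)
open import Data.Fin using (Fin; zero; suc; _≟_)
open import Data.Rational using (ℚ; 0ℚ; _+_; _⊓_) renaming (_≤_ to _≤ℚ_)
open import Data.Product using (Σ; ∃; _×_; _,_)
open import Relation.Binary.PropositionalEquality using (_≡_; _≢_)
open import Relation.Nullary using (yes; no)
open import Function.Definitions using (Surjective)

-- A (finite) complete multipartite graph with at least two nonempty parts,
-- on vertex set Fin m: vertex v lies in part (part v) ∈ Fin k, k ≥ 2,
-- every part is nonempty (part is surjective), and two vertices are
-- adjacent iff they lie in different parts.
record CompleteMultipartite (m : ℕ) : Set where
  field
    k        : ℕ
    twoParts : 2 ≤ k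
    part     : Fin m → Fin k
    nonempty : Surjective _≡_ _≡_ part

Adj : ∀ {m} → CompleteMultipartite m → Fin m → Fin m → Set
Adj G v w = CompleteMultipartite.part G v ≢ CompleteMultipartite.part G w

data Reach {m} (G : CompleteMultipartite m) (X : Fin m → Set) (v : Fin m) : Fin m → Set where
  here : X v → Reach G X v v
  step : ∀ {u w} → Reach G X v u → Adj G u w → X w → Reach G X v w

-- X induces a connected subgraph of G (the empty set counts as connected).
IsBundle : ∀ {m} → CompleteMultipartite m → (Fin m → Set) → Set
IsBundle G X = ∀ v w → X v → X w → Reach G X v w

Part : ∀ {m n} → (Fin m → Fin n) → Fin n → Fin m → Set
Part f j v = f v ≡ j

-- (G,n)-partition: pairwise disjoint bundles covering V(G)
-- (disjointness and covering are automatic for an assignment).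
IsPartition : ∀ {m n} → CompleteMultipartite m → (Fin m → Fin n) → Set
IsPartition {n = n} G f = ∀ (j : Fin n) → IsBundle G (Part f j)

sumFin : ∀ m → (Fin m → ℚ) → ℚ
sumFin zero    g = 0ℚ
sumFin (suc m) g = g zero + sumFin m (λ i → g (suc i))

value : ∀ {m n} → (Fin m → ℚ) → (Fin m → Fin n) → Fin n → ℚ
value {m} u f j = sumFin m (λ v → indicator (f v ≟ j) (u v))
  where
  indicator : ∀ {A : Set} → Relation.Nullary.Dec A → ℚ → ℚ
  indicator (yes _) x = x
  indicator (no _)  x = 0ℚ

minFin : ∀ n → (Fin (suc n) → ℚ) → ℚ
minFin zero    g = g zero
minFin (suc n) g = g zero ⊓ minFin n (λ i → g (suc i))

minValue : ∀ {m n'} → (Fin m → ℚ) → (Fin m → Fin (suc n')) → ℚ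
minValue {n' = n'} u f = minFin n' (value u f)

-- μ = mms^{(n)}(G,u): the maximum over all (G,n)-partitions of min_j u(P_j)
-- (attained by some partition, and an upper bound for every partition).
IsMMS : ∀ {m} → CompleteMultipartite m → (n' : ℕ) → (Fin m → ℚ) → ℚ → Set
IsMMS {m} G n' u μ =
  (Σ (Fin m → Fin (suc n')) λ f → IsPartition G f × minValue u f ≡ μ)
  × (∀ (f : Fin m → Fin (suc n')) → IsPartition G f → minValue u f ≤ℚ μ)

{-# OPTIONS --safe #-}
module Submission where

-- In a complete multipartite graph a vertex set is connected iff it has at most one vertex or
-- meets two parts. The argument below needs only thresholds τᵢ with τᵢ + τᵢ ≤ μᵢ, so τᵢ = μᵢ/4
-- (or even μᵢ/2) works; every agent i has a partition into connected blocks worth at least μᵢ.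
--
-- While some waiting agent values a single free vertex at least τ, give it that vertex. Such a
-- vertex lies in one block of each partition, so every waiting agent keeps at least as many
-- untouched blocks as there are waiting agents, say r. Then every free vertex is worth less than
-- τ to every waiting agent, so each untouched block of one waiting agent, being connected and
-- worth at least 2τ, meets two parts; r of them yield r disjoint crossing pairs, the seeds. Now
-- bag-fill: grow the first seed, avoiding the other seeds, one vertex at a time until some
-- waiting agent values it at least τ, and give it to that agent. To every other waiting agent
-- the bag and each remaining seed are worth at most 2τ, so each keeps 2τ of free value per
-- remaining seed; the bag contains a crossing pair, hence is connected. Finally the leftover
-- free vertices go to the owner of a vertex in another part, which keeps that bundle connected.

open import Defs
open import Data.Nat using (ℕ; suc)
open import Data.Fin using (Fin)
open import Data.Rational using (ℚ; 0ℚ; _*_; ½) renaming (_≤_ to _≤ℚ_)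
open import Data.Product using (Σ; _×_)

open import Algebra.Bundles using (CommutativeMonoid)
open import Data.Bool using (if_then_else_)
open import Data.Empty using (⊥-elim)
open import Data.Fin using (zero; suc; _≟_)
open import Data.Fin.Properties using (any?)
open import Data.Fin.Subset
  using (Subset; inside; outside; _∈_; _∉_; _⊆_; _∪_; _∩_; _─_; _-_; ⁅_⁆; ⊥; ⋃; ∣_∣; Empty)
open import Data.Fin.Subset.Properties
  using (_∈?_; nonempty?; Empty-unique; drop-∷-⊆; ⊥⊆; ∉⊥; ∣p∣≤n; x∈⁅x⁆; x∈⁅y⁆⇒x≡y; x∉⁅y⁆⇒x≢y;
         ⊆-refl; ⊆-trans; ⊆-antisym; p⊆p∪q; q⊆p∪q; x∈p∪q⁺; x∈p∪q⁻; p∩q⊆q; x∈p∩q⁺; p─q⊆p;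
         x∈p∧x∉q⇒x∈p─q; x∈p∧x≢y⇒x∈p-y; x∈p⇒∣p-x∣<∣p∣)
open import Data.List using (List; []; _∷_; length; filter; take; map; allFin)
open import Data.List.Properties using (filter-all; length-take; length-map; length-tabulate)
open import Data.List.Membership.Propositional using () renaming (_∈_ to _∈ₗ_)
open import Data.List.Membership.Propositional.Properties using (∈-allFin)
open import Data.List.Relation.Unary.All as All using (All; []; _∷_)
import Data.List.Relation.Unary.All.Properties as All
open import Data.List.Relation.Unary.AllPairs as AllPairs using (AllPairs; []; _∷_)
import Data.List.Relation.Unary.AllPairs.Properties as AllPairs
open import Data.List.Relation.Unary.Any as Any using ()
open import Data.List.Relation.Unary.Unique.Propositional using (Unique)
import Data.List.Relation.Unary.Unique.Propositional.Properties as Unique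
open import Data.Maybe using (Maybe; just; nothing; fromMaybe)
open import Data.Maybe.Properties using (≡-dec; just-injective)
import Data.Nat as ℕ
import Data.Nat.Properties as ℕ
open import Data.Product using (∃; ∃₂; _,_; proj₁; proj₂)
open import Data.Rational using (1ℚ; _+_; _≤_; _<_; _≤?_; _<?_; +-0-rawMonoid)
open import Data.Rational.Properties
  using (≤-refl; ≤-reflexive; ≤-trans; <⇒≤; ≰⇒>; ≮⇒≥; <-irrefl; <-≤-trans; ≤-<-trans; p⊓q≤p; p⊓q≤q;
         +-assoc; +-identityˡ; +-identityʳ; +-mono-≤; +-monoˡ-≤; +-monoʳ-≤; +-mono-<; +-mono-<-≤; +-mono-≤-<;
         *-distribʳ-+; *-identityˡ; +-0-commutativeMonoid; module ≤-Reasoning)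
open import Data.Sum using (_⊎_; inj₁; inj₂)
open import Data.Vec using ([]; _∷_; here; there; tabulate)
open import Data.Vec.Properties using (lookup∘tabulate; lookup⇒[]=; []=⇒lookup)
open import Function using (_∘_; id)
open import Level using (0ℓ)
open import Relation.Binary.Definitions using (DecidableEquality)
open import Relation.Binary.PropositionalEquality
  using (_≡_; _≢_; ≢-sym; refl; sym; trans; cong; cong₂; subst; module ≡-Reasoning)
open import Relation.Nullary using (Dec; yes; no; does; ¬_; ¬?)
open import Relation.Nullary.Decidable using (dec-true; dec-false; _×-dec_)
open import Relation.Unary using (Pred; Decidable)

open import Algebra.Definitions.RawMonoid +-0-rawMonoid using () renaming (_×_ to _·_)
open import Algebra.Properties.CommutativeSemigroup
  (CommutativeMonoid.commutativeSemigroup +-0-commutativeMonoid) using (x∙yz≈y∙xz)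

p≤q+p : ∀ {p q} → 0ℚ ≤ q → p ≤ q + p
p≤q+p {p} 0≤q = ≤-trans (≤-reflexive (sym (+-identityˡ p))) (+-monoˡ-≤ p 0≤q)

≤-cancelˡ-+ : ∀ {a b c d} → a + b ≤ c + d → c ≤ a → b ≤ d
≤-cancelˡ-+ a+b≤c+d c≤a = ≮⇒≥ λ d<b → <-irrefl refl (<-≤-trans (+-mono-≤-< c≤a d<b) a+b≤c+d)

≤-cancelʳ-+ : ∀ {a b c d} → a + b ≤ c + d → d ≤ b → a ≤ c
≤-cancelʳ-+ a+b≤c+d d≤b = ≮⇒≥ λ c<a → <-irrefl refl (<-≤-trans (+-mono-<-≤ c<a d≤b) a+b≤c+d)

minFin-≤ : ∀ n (g : Fin (suc n) → ℚ) j → minFin n g ≤ g j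
minFin-≤ ℕ.zero  g zero    = ≤-refl
minFin-≤ (suc n) g zero    = p⊓q≤p _ _
minFin-≤ (suc n) g (suc j) = ≤-trans (p⊓q≤q (g zero) _) (minFin-≤ n (g ∘ suc) j)

length-take-≤ : ∀ {A : Set} {n} {xs : List A} → n ℕ.≤ length xs → length (take n xs) ≡ n
length-take-≤ {n = n} {xs} n≤∣xs∣ = trans (length-take n xs) (ℕ.m≤n⇒m⊓n≡m n≤∣xs∣)

length-filter-≢ : ∀ {A : Set} (_≟ᴬ_ : DecidableEquality A) x {xs} → Unique xs →
                  length xs ℕ.≤ suc (length (filter (λ y → ¬? (y ≟ᴬ x)) xs))
length-filter-≢ _≟ᴬ_ x {[]}     []            = ℕ.z≤n
length-filter-≢ _≟ᴬ_ x {y ∷ ys} (y∉ys ∷ uniq) with y ≟ᴬ x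
... | yes refl = ℕ.≤-reflexive (cong (suc ∘ length) (sym (filter-all (λ z → ¬? (z ≟ᴬ x)) (All.map ≢-sym y∉ys))))
... | no  _    = ℕ.s≤s (length-filter-≢ _≟ᴬ_ x uniq)

other-element : ∀ {k} → 2 ℕ.≤ k → (p : Fin k) → ∃ λ q → p ≢ q
other-element (ℕ.s≤s (ℕ.s≤s _)) zero    = suc zero , λ ()
other-element (ℕ.s≤s (ℕ.s≤s _)) (suc _) = zero , λ ()

just≢nothing : ∀ {A : Set} {x : A} → just x ≢ nothing
just≢nothing ()

subset : ∀ {n} {P : Pred (Fin n) 0ℓ} → Decidable P → Subset n
subset P? = tabulate (does ∘ P?)

module _ {n} {P : Pred (Fin n) 0ℓ} (P? : Decidable P) where

  ∈-subset⁺ : ∀ {x} → P x → x ∈ subset P?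
  ∈-subset⁺ {x} Px = lookup⇒[]= x _ (trans (lookup∘tabulate (does ∘ P?) x) (dec-true (P? x) Px))

  ∈-subset⁻ : ∀ {x} → x ∈ subset P? → P x
  ∈-subset⁻ {x} x∈ with P? x | trans (sym (lookup∘tabulate (does ∘ P?) x)) ([]=⇒lookup x∈)
  ... | yes Px | _ = Px
  ... | no  _  | ()

x∈p─q⇒x∉q : ∀ {n} (p q : Subset n) {x} → x ∈ p ─ q → x ∉ q
x∈p─q⇒x∉q (_ ∷ p) (inside ∷ q) ()        here
x∈p─q⇒x∉q (_ ∷ p) (_ ∷ q)      (there x∈) (there x∈q) = x∈p─q⇒x∉q p q x∈ x∈q

x∈p-y⇒x≢y : ∀ {n} (p : Subset n) {x y} → x ∈ p - y → x ≢ y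
x∈p-y⇒x≢y p {y = y} x∈p-y = x∉⁅y⁆⇒x≢y (x∈p─q⇒x∉q p ⁅ y ⁆ x∈p-y)

x∈p∧∣p∣≤1+r⇒∣p-x∣≤r : ∀ {n r} {p : Subset n} {x} → x ∈ p → ∣ p ∣ ℕ.≤ suc r → ∣ p - x ∣ ℕ.≤ r
x∈p∧∣p∣≤1+r⇒∣p-x∣≤r x∈p ∣p∣≤1+r = ℕ.≤-pred (ℕ.≤-trans (x∈p⇒∣p-x∣<∣p∣ x∈p) ∣p∣≤1+r)

∣p∣≤0⇒Empty : ∀ {n} {p : Subset n} → ∣ p ∣ ℕ.≤ 0 → Empty p
∣p∣≤0⇒Empty ∣p∣≤0 (x , x∈p) = ℕ.n≮0 (ℕ.<-≤-trans (x∈p⇒∣p-x∣<∣p∣ x∈p) ∣p∣≤0)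

⊆-⋃ : ∀ {n} (ps : List (Subset n)) → All (_⊆ ⋃ ps) ps
⊆-⋃ []       = []
⊆-⋃ (p ∷ ps) = p⊆p∪q (⋃ ps) ∷ All.map weaken (⊆-⋃ ps)
  where
  weaken : ∀ {q} → q ⊆ ⋃ ps → q ⊆ p ∪ ⋃ ps
  weaken q⊆⋃ = ⊆-trans q⊆⋃ (q⊆p∪q p (⋃ ps))

Disjoint : ∀ {n} → Subset n → Subset n → Set
Disjoint p q = ∀ {x} → x ∈ p → x ∉ q

disjoint-⋃ : ∀ {n} {p : Subset n} {qs} → All (Disjoint p) qs → Disjoint p (⋃ qs)
disjoint-⋃ []                         _   x∈⊥ = ∉⊥ x∈⊥
disjoint-⋃ {qs = q ∷ qs} (p#q ∷ p#qs) x∈p x∈⋃ with x∈p∪q⁻ q (⋃ qs) x∈⋃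
... | inj₁ x∈q   = p#q x∈p x∈q
... | inj₂ x∈⋃qs = disjoint-⋃ p#qs x∈p x∈⋃qs

weight : ∀ {m} → (Fin m → ℚ) → Subset m → ℚ
weight u []            = 0ℚ
weight u (inside ∷ p)  = u zero + weight (u ∘ suc) p
weight u (outside ∷ p) = weight (u ∘ suc) p

weight-⊥ : ∀ {m} (u : Fin m → ℚ) → weight u ⊥ ≡ 0ℚ
weight-⊥ {ℕ.zero} u = refl
weight-⊥ {suc m}  u = weight-⊥ (u ∘ suc)

weight-⁅⁆ : ∀ {m} (u : Fin m → ℚ) x → weight u ⁅ x ⁆ ≡ u x
weight-⁅⁆ u zero    = trans (cong (u zero +_) (weight-⊥ (u ∘ suc))) (+-identityʳ (u zero))
weight-⁅⁆ u (suc x) = weight-⁅⁆ (u ∘ suc) x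

weight-split : ∀ {m} (u : Fin m → ℚ) p q → weight u p ≡ weight u (p ∩ q) + weight u (p ─ q)
weight-split u []            []            = sym (+-identityˡ 0ℚ)
weight-split u (inside ∷ p)  (inside ∷ q)  =
  trans (cong (u zero +_) (weight-split (u ∘ suc) p q)) (sym (+-assoc (u zero) _ _))
weight-split u (inside ∷ p)  (outside ∷ q) =
  trans (cong (u zero +_) (weight-split (u ∘ suc) p q))
        (x∙yz≈y∙xz (u zero) (weight (u ∘ suc) (p ∩ q)) (weight (u ∘ suc) (p ─ q)))
weight-split u (outside ∷ p) (inside ∷ q)  = weight-split (u ∘ suc) p q
weight-split u (outside ∷ p) (outside ∷ q) = weight-split (u ∘ suc) p q

weight-mono : ∀ {m} {u : Fin m → ℚ} → (∀ v → 0ℚ ≤ u v) → ∀ {p q} → p ⊆ q → weight u p ≤ weight u q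
weight-mono         u≥0 {[]}          {[]}          _   = ≤-refl
weight-mono {u = u} u≥0 {inside ∷ p}  {inside ∷ q}  p⊆q =
  +-monoʳ-≤ (u zero) (weight-mono (u≥0 ∘ suc) (drop-∷-⊆ p⊆q))
weight-mono         u≥0 {inside ∷ p}  {outside ∷ q} p⊆q with p⊆q here
... | ()
weight-mono         u≥0 {outside ∷ p} {inside ∷ q}  p⊆q =
  ≤-trans (weight-mono (u≥0 ∘ suc) (drop-∷-⊆ p⊆q)) (p≤q+p (u≥0 zero))
weight-mono         u≥0 {outside ∷ p} {outside ∷ q} p⊆q = weight-mono (u≥0 ∘ suc) (drop-∷-⊆ p⊆q)

value≡weight : ∀ {m n} (u : Fin m → ℚ) (f : Fin m → Fin n) j → value u f j ≡ weight u (subset (λ v → f v ≟ j))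
value≡weight {ℕ.zero} u f j = refl
value≡weight {suc m}  u f j with f zero ≟ j
... | yes _ = cong (u zero +_) (value≡weight (u ∘ suc) (f ∘ suc) j)
... | no  _ = trans (+-identityˡ _) (value≡weight (u ∘ suc) (f ∘ suc) j)

module _ {m} {u : Fin m → ℚ} (u≥0 : ∀ v → 0ℚ ≤ u v) where

  weight-nonneg : ∀ p → 0ℚ ≤ weight u p
  weight-nonneg p = subst (_≤ weight u p) (weight-⊥ u) (weight-mono u≥0 {q = p} ⊥⊆)

  weight-∪ : ∀ p q → weight u (p ∪ q) ≤ weight u p + weight u q
  weight-∪ p q = begin
    weight u (p ∪ q)                              ≡⟨ weight-split u (p ∪ q) p ⟩
    weight u ((p ∪ q) ∩ p) + weight u (p ∪ q ─ p) ≤⟨ +-mono-≤ (weight-mono u≥0 (p∩q⊆q (p ∪ q) p))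
                                                               (weight-mono u≥0 rest⊆q) ⟩
    weight u p + weight u q                       ∎
    where
    open ≤-Reasoning
    rest⊆q : p ∪ q ─ p ⊆ q
    rest⊆q {x} x∈ with x∈p∪q⁻ p q (p─q⊆p (p ∪ q) p x∈)
    ... | inj₁ x∈p = ⊥-elim (x∈p─q⇒x∉q (p ∪ q) p x∈ x∈p)
    ... | inj₂ x∈q = x∈q

  weight-cover : ∀ {r} p q → r ⊆ p ∪ q → weight u r ≤ weight u p + weight u q
  weight-cover p q r⊆p∪q = ≤-trans (weight-mono u≥0 r⊆p∪q) (weight-∪ p q)

  weight-⋃ : ∀ {d} ps → All (λ p → weight u p ≤ d) ps → weight u (⋃ ps) ≤ length ps · d
  weight-⋃ []       []           = ≤-reflexive (weight-⊥ u)
  weight-⋃ (p ∷ ps) (p≤d ∷ ps≤d) = ≤-trans (weight-∪ p (⋃ ps)) (+-mono-≤ p≤d (weight-⋃ ps ps≤d))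

  weight-⊇-disjoint : ∀ {d F} ps → AllPairs Disjoint ps → All (_⊆ F) ps → All (λ p → d ≤ weight u p) ps →
                      length ps · d ≤ weight u F
  weight-⊇-disjoint {F = F} []       []            []           []           = weight-nonneg F
  weight-⊇-disjoint {d} {F} (p ∷ ps) (p#ps ∷ disj) (p⊆F ∷ ps⊆F) (d≤p ∷ d≤ps) = begin
    d + length ps · d                   ≤⟨ +-mono-≤ (≤-trans d≤p (weight-mono u≥0 p⊆F∩p))
                                                    (weight-⊇-disjoint ps disj ps⊆F─p d≤ps) ⟩
    weight u (F ∩ p) + weight u (F ─ p) ≡⟨ sym (weight-split u F p) ⟩
    weight u F                          ∎
    where
    open ≤-Reasoning
    p⊆F∩p : p ⊆ F ∩ p
    p⊆F∩p x∈p = x∈p∩q⁺ (p⊆F x∈p , x∈p)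
    outside-p : ∀ {q} → Disjoint p q × q ⊆ F → q ⊆ F ─ p
    outside-p (p#q , q⊆F) x∈q = x∈p∧x∉q⇒x∈p─q (q⊆F x∈q) (λ x∈p → p#q x∈p x∈q)
    ps⊆F─p : All (_⊆ F ─ p) ps
    ps⊆F─p = All.zipWith outside-p (p#ps , ps⊆F)

  weight-subsingleton : ∀ {p t} → (∀ {v w} → v ∈ p → w ∈ p → v ≡ w) → (∀ {v} → v ∈ p → u v < t) → 0ℚ < t →
                        weight u p < t
  weight-subsingleton {p} sub small 0<t with nonempty? p
  ... | yes (x , x∈p) = ≤-<-trans (≤-trans (weight-mono u≥0 p⊆⁅x⁆) (≤-reflexive (weight-⁅⁆ u x))) (small x∈p)
    where
    p⊆⁅x⁆ : p ⊆ ⁅ x ⁆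
    p⊆⁅x⁆ y∈p = subst (_∈ ⁅ x ⁆) (sub x∈p y∈p) (x∈⁅x⁆ x)
  ... | no  p-empty rewrite Empty-unique p-empty = subst (_< _) (sym (weight-⊥ u)) 0<t

module _ {m} (G : CompleteMultipartite m) where
  open CompleteMultipartite G

  Crossing : (Fin m → Set) → Set
  Crossing X = ∃₂ λ a b → X a × X b × Adj G a b

  crossing-⊆ : ∀ {X Y : Fin m → Set} → (∀ {x} → X x → Y x) → Crossing X → Crossing Y
  crossing-⊆ X⊆Y (a , b , Xa , Xb , a≁b) = a , b , X⊆Y Xa , X⊆Y Xb , a≁b

  crossing? : ∀ p → Dec (Crossing (_∈ p))
  crossing? p = any? λ a → any? λ b → (a ∈? p) ×-dec (b ∈? p) ×-dec ¬? (part a ≟ part b)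

  neighbour : ∀ v → ∃ λ w → Adj G v w
  neighbour v with other-element twoParts (part v)
  ... | q , p≢q = proj₁ (nonempty q) , λ p≡ → p≢q (trans p≡ (proj₂ (nonempty q) refl))

  reach-map : ∀ {X Y : Fin m → Set} {v w} → (∀ {x} → X x → Y x) → Reach G X v w → Reach G Y v w
  reach-map X⊆Y (here Xv)       = here (X⊆Y Xv)
  reach-map X⊆Y (step r adj Xw) = step (reach-map X⊆Y r) adj (X⊆Y Xw)

  bundle-resp : ∀ {X Y : Fin m → Set} → (∀ {x} → X x → Y x) → (∀ {x} → Y x → X x) →
                IsBundle G X → IsBundle G Y
  bundle-resp X⊆Y Y⊆X X-bundle v w Yv Yw = reach-map X⊆Y (X-bundle v w (Y⊆X Yv) (Y⊆X Yw))

  subsingleton⇒bundle : ∀ {X : Fin m → Set} → (∀ {v w} → X v → X w → v ≡ w) → IsBundle G X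
  subsingleton⇒bundle sub v w Xv Xw with sub Xv Xw
  ... | refl = here Xv

  -- A walk of length two through a or b joins any two vertices of one part.
  crossing⇒bundle : ∀ {X : Fin m → Set} → Crossing X → IsBundle G X
  crossing⇒bundle (a , b , Xa , Xb , a≁b) v w Xv Xw with part v ≟ part w
  ... | no  v≁w = step (here Xv) v≁w Xw
  ... | yes v∼w with part v ≟ part a
  ...   | no  v≁a = step (step (here Xv) v≁a Xa) (λ a∼w → v≁a (trans v∼w (sym a∼w))) Xw
  ...   | yes v∼a = step (step (here Xv) (λ v∼b → a≁b (trans (sym v∼a) v∼b)) Xb)
                         (λ b∼w → a≁b (trans (sym v∼a) (trans v∼w (sym b∼w)))) Xw

  bundle⇒crossing : ∀ {X : Fin m → Set} {v w} → IsBundle G X → X v → X w → v ≢ w → Crossing X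
  bundle⇒crossing {X} {v} {w} X-bundle Xv Xw v≢w = crossing (X-bundle v w Xv Xw) v≢w
    where
    endpoint : ∀ {a b} → Reach G X a b → X b
    endpoint (here Xa)     = Xa
    endpoint (step _ _ Xb) = Xb
    crossing : ∀ {a b} → Reach G X a b → a ≢ b → Crossing X
    crossing (here _)        a≢a = ⊥-elim (a≢a refl)
    crossing (step r adj Xb) _   = _ , _ , endpoint r , Xb , adj

  heavy-bundle-crossing : ∀ {u : Fin m → ℚ} {t p} → (∀ v → 0ℚ ≤ u v) → IsBundle G (_∈ p) →
                          (∀ {v} → v ∈ p → u v < t) → 0ℚ < t → t ≤ weight u p → Crossing (_∈ p)
  heavy-bundle-crossing {p = p} u≥0 p-bundle small 0<t t≤p with crossing? p
  ... | yes crossing = crossing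
  ... | no ¬crossing = ⊥-elim (<-irrefl refl (<-≤-trans (weight-subsingleton u≥0 subsingleton small 0<t) t≤p))
    where
    subsingleton : ∀ {v w} → v ∈ p → w ∈ p → v ≡ w
    subsingleton {v} {w} v∈p w∈p with v ≟ w
    ... | yes v≡w = v≡w
    ... | no  v≢w = ⊥-elim (¬crossing (bundle⇒crossing p-bundle v∈p w∈p v≢w))

  crossingPair : Subset m → Subset m
  crossingPair p with crossing? p
  ... | yes (a , b , _) = ⁅ a ⁆ ∪ ⁅ b ⁆
  ... | no  _           = ⊥

  crossingPair-⊆ : ∀ p → crossingPair p ⊆ p
  crossingPair-⊆ p x∈ with crossing? p
  ... | no  _ = ⊥-elim (∉⊥ x∈)
  ... | yes (a , b , a∈p , b∈p , _) with x∈p∪q⁻ ⁅ a ⁆ ⁅ b ⁆ x∈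
  ...   | inj₁ x∈⁅a⁆ = subst (_∈ p) (sym (x∈⁅y⁆⇒x≡y a x∈⁅a⁆)) a∈p
  ...   | inj₂ x∈⁅b⁆ = subst (_∈ p) (sym (x∈⁅y⁆⇒x≡y b x∈⁅b⁆)) b∈p

  crossingPair-crossing : ∀ p → Crossing (_∈ p) → Crossing (_∈ crossingPair p)
  crossingPair-crossing p crossing with crossing? p
  ... | no  ¬crossing             = ⊥-elim (¬crossing crossing)
  ... | yes (a , b , _ , _ , a≁b) = a , b , x∈p∪q⁺ (inj₁ (x∈⁅x⁆ a)) , x∈p∪q⁺ (inj₂ (x∈⁅x⁆ b)) , a≁b

  crossingPair-weight : ∀ {u : Fin m → ℚ} {t} p → (∀ v → 0ℚ ≤ u v) → 0ℚ ≤ t → (∀ {v} → v ∈ p → u v ≤ t) →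
                        weight u (crossingPair p) ≤ t + t
  crossingPair-weight {u} {t} p u≥0 0≤t small with crossing? p
  ... | no  _                       = subst (_≤ t + t) (sym (weight-⊥ u)) (+-mono-≤ 0≤t 0≤t)
  ... | yes (a , b , a∈p , b∈p , _) = begin
    weight u (⁅ a ⁆ ∪ ⁅ b ⁆)        ≤⟨ weight-∪ u≥0 ⁅ a ⁆ ⁅ b ⁆ ⟩
    weight u ⁅ a ⁆ + weight u ⁅ b ⁆ ≡⟨ cong₂ _+_ (weight-⁅⁆ u a) (weight-⁅⁆ u b) ⟩
    u a + u b                       ≤⟨ +-mono-≤ (small a∈p) (small b∈p) ⟩
    t + t                           ∎
    where open ≤-Reasoning

module BagFilling {m n} (u : Fin n → Fin m → ℚ) (u≥0 : ∀ k v → 0ℚ ≤ u k v) (t : Fin n → ℚ)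
  (R : Subset n) (X : Subset m) (small : ∀ {k} → k ∈ R → ∀ {v} → v ∈ X → u k v ≤ t k) where

  Light : Subset m → Set
  Light B = ∀ {k} → k ∈ R → weight (u k) B ≤ t k + t k

  Claimed : Subset m → Set
  Claimed B = ∃ λ k → k ∈ R × t k ≤ weight (u k) B

  Filled : Subset m → Set
  Filled B₀ = ∃ λ B → B₀ ⊆ B × B ⊆ X × Light B × Claimed B

  claimed? : ∀ B → Dec (Claimed B)
  claimed? B = any? λ k → (k ∈? R) ×-dec (t k ≤? weight (u k) B)

  -- A bag that nobody claims is worth less than t k to every k, so adding one vertex keeps it light.
  fill : ∀ ys {B} → B ⊆ X → Light B → (∀ {x} → x ∈ X → x ∈ B ⊎ x ∈ₗ ys) → Claimed X → Filled B
  fill ys {B} B⊆X light cover claimed-X with claimed? B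
  ... | yes claimed-B = B , ⊆-refl , B⊆X , light , claimed-B
  fill [] {B} B⊆X light cover (k , k∈R , t≤X) | no ¬claimed-B =
    ⊥-elim (¬claimed-B (k , k∈R , ≤-trans t≤X (weight-mono (u≥0 k) X⊆B)))
    where
    X⊆B : X ⊆ B
    X⊆B x∈X with cover x∈X
    ... | inj₁ x∈B = x∈B
  fill (y ∷ ys) {B} B⊆X light cover claimed-X | no ¬claimed-B with y ∈? X
  ... | no y∉X = fill ys B⊆X light cover′ claimed-X
    where
    cover′ : ∀ {x} → x ∈ X → x ∈ B ⊎ x ∈ₗ ys
    cover′ x∈X with cover x∈X
    ... | inj₁ x∈B              = inj₁ x∈B
    ... | inj₂ (Any.here refl)  = ⊥-elim (y∉X x∈X)
    ... | inj₂ (Any.there x∈ys) = inj₂ x∈ys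
  ... | yes y∈X =
    let B′ , B∪y⊆B′ , filled = fill ys {B ∪ ⁅ y ⁆} B∪y⊆X light′ cover′ claimed-X
    in B′ , ⊆-trans (p⊆p∪q ⁅ y ⁆) B∪y⊆B′ , filled
    where
    B∪y⊆X : B ∪ ⁅ y ⁆ ⊆ X
    B∪y⊆X x∈ with x∈p∪q⁻ B ⁅ y ⁆ x∈
    ... | inj₁ x∈B   = B⊆X x∈B
    ... | inj₂ x∈⁅y⁆ = subst (_∈ X) (sym (x∈⁅y⁆⇒x≡y y x∈⁅y⁆)) y∈X
    light′ : Light (B ∪ ⁅ y ⁆)
    light′ {k} k∈R = begin
      weight (u k) (B ∪ ⁅ y ⁆)            ≤⟨ weight-∪ (u≥0 k) B ⁅ y ⁆ ⟩
      weight (u k) B + weight (u k) ⁅ y ⁆ ≡⟨ cong (weight (u k) B +_) (weight-⁅⁆ (u k) y) ⟩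
      weight (u k) B + u k y              ≤⟨ +-mono-≤ (<⇒≤ (≰⇒> λ t≤B → ¬claimed-B (k , k∈R , t≤B)))
                                                      (small k∈R y∈X) ⟩
      t k + t k                           ∎
      where open ≤-Reasoning
    cover′ : ∀ {x} → x ∈ X → x ∈ B ∪ ⁅ y ⁆ ⊎ x ∈ₗ ys
    cover′ x∈X with cover x∈X
    ... | inj₁ x∈B              = inj₁ (p⊆p∪q ⁅ y ⁆ x∈B)
    ... | inj₂ (Any.here refl)  = inj₁ (q⊆p∪q B ⁅ y ⁆ (x∈⁅x⁆ y))
    ... | inj₂ (Any.there x∈ys) = inj₂ x∈ys

  fillBag : ∀ {B₀} → B₀ ⊆ X → Light B₀ → Claimed X → Filled B₀
  fillBag B₀⊆X light = fill (allFin m) B₀⊆X light (λ _ → inj₂ (∈-allFin _))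

Allocation : ℕ → ℕ → Set
Allocation m n = Fin m → Maybe (Fin n)

module _ {m n : ℕ} where

  _≟ₘ_ : DecidableEquality (Maybe (Fin n))
  _≟ₘ_ = ≡-dec _≟_

  free : Allocation m n → Subset m
  free own = subset (λ v → own v ≟ₘ nothing)

  bundle : Allocation m n → Fin n → Subset m
  bundle own i = subset (λ v → own v ≟ₘ just i)

  module _ (own : Allocation m n) {v : Fin m} where

    ∈-free⁺ : own v ≡ nothing → v ∈ free own
    ∈-free⁺ = ∈-subset⁺ (λ w → own w ≟ₘ nothing)

    ∈-free⁻ : v ∈ free own → own v ≡ nothing
    ∈-free⁻ = ∈-subset⁻ (λ w → own w ≟ₘ nothing)

    ∈-bundle⁺ : ∀ {i} → own v ≡ just i → v ∈ bundle own i
    ∈-bundle⁺ {i} = ∈-subset⁺ (λ w → own w ≟ₘ just i)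

    ∈-bundle⁻ : ∀ {i} → v ∈ bundle own i → own v ≡ just i
    ∈-bundle⁻ {i} = ∈-subset⁻ (λ w → own w ≟ₘ just i)

  give : Subset m → Fin n → Allocation m n → Allocation m n
  give B k own v = if does (v ∈? B) then just k else own v

  module _ {B : Subset m} {k : Fin n} {own : Allocation m n} where

    give-∈ : ∀ {v} → v ∈ B → give B k own v ≡ just k
    give-∈ {v} v∈B rewrite dec-true (v ∈? B) v∈B = refl

    give-∉ : ∀ {v} → v ∉ B → give B k own v ≡ own v
    give-∉ {v} v∉B rewrite dec-false (v ∈? B) v∉B = refl

    free-give⁺ : ∀ {v} → v ∈ free own → v ∉ B → v ∈ free (give B k own)
    free-give⁺ v∈free v∉B = ∈-free⁺ (give B k own) (trans (give-∉ v∉B) (∈-free⁻ own v∈free))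

    free-give⁻ : ∀ {v} → v ∈ free (give B k own) → v ∈ free own × v ∉ B
    free-give⁻ {v} v∈free with v ∈? B
    ... | yes v∈B = ⊥-elim (just≢nothing (trans (sym (give-∈ v∈B)) (∈-free⁻ (give B k own) v∈free)))
    ... | no  v∉B = ∈-free⁺ own (trans (sym (give-∉ v∉B)) (∈-free⁻ (give B k own) v∈free)) , v∉B

    bundle-give-self : bundle own k ≡ ⊥ → bundle (give B k own) k ≡ B
    bundle-give-self k-unserved = ⊆-antisym to (λ v∈B → ∈-bundle⁺ (give B k own) (give-∈ v∈B))
      where
      to : bundle (give B k own) k ⊆ B
      to {v} v∈ with v ∈? B
      ... | yes v∈B = v∈B
      ... | no  v∉B = ⊥-elim (∉⊥ (subst (v ∈_) k-unserved
                                   (∈-bundle⁺ own (trans (sym (give-∉ v∉B)) (∈-bundle⁻ (give B k own) v∈)))))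

    bundle-give-other : ∀ {i} → B ⊆ free own → i ≢ k → bundle (give B k own) i ≡ bundle own i
    bundle-give-other {i} B⊆free i≢k = ⊆-antisym to from
      where
      to : bundle (give B k own) i ⊆ bundle own i
      to {v} v∈ with v ∈? B
      ... | yes v∈B = ⊥-elim (i≢k (just-injective (trans (sym (∈-bundle⁻ (give B k own) v∈)) (give-∈ v∈B))))
      ... | no  v∉B = ∈-bundle⁺ own (trans (sym (give-∉ v∉B)) (∈-bundle⁻ (give B k own) v∈))
      from : bundle own i ⊆ bundle (give B k own) i
      from {v} v∈ with v ∈? B
      ... | yes v∈B = ⊥-elim (just≢nothing (trans (sym (∈-bundle⁻ own v∈)) (∈-free⁻ own (B⊆free v∈B))))
      ... | no  v∉B = ∈-bundle⁺ (give B k own) (trans (give-∉ v∉B) (∈-bundle⁻ own v∈))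

module _ {m n} (G : CompleteMultipartite m) (own : Allocation m (suc n)) where

  complete : Fin (suc n) → Fin m → Fin (suc n)
  complete h v = fromMaybe h (own v)

  absorber : ∃ λ h → Empty (free own) ⊎ Crossing G (Part (complete h) h)
  absorber with nonempty? (free own)
  ... | no  none         = zero , inj₁ none
  ... | yes (l , l∈free) with neighbour G l
  ...   | w , l≁w = fromMaybe zero (own w) , inj₂ (l , w , l↦h , w↦h , l≁w)
    where
    l↦h : complete (fromMaybe zero (own w)) l ≡ fromMaybe zero (own w)
    l↦h = cong (fromMaybe _) (∈-free⁻ own l∈free)
    w↦h : complete (fromMaybe zero (own w)) w ≡ fromMaybe zero (own w)
    w↦h with own w
    ... | just _  = refl
    ... | nothing = refl

  bundle⇒complete : ∀ {h j v} → v ∈ bundle own j → complete h v ≡ j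
  bundle⇒complete {h} v∈ = cong (fromMaybe h) (∈-bundle⁻ own v∈)

  complete⇒bundle : ∀ {h j v} → (v ∈ free own → h ≢ j) → complete h v ≡ j → v ∈ bundle own j
  complete⇒bundle {v = v} not-absorbed v↦j with own v in eq
  ... | just i  = ∈-bundle⁺ own (trans eq (cong just v↦j))
  ... | nothing = ⊥-elim (not-absorbed (∈-free⁺ own eq) v↦j)

  bundle⊆complete : ∀ {h j} → bundle own j ⊆ subset (λ v → complete h v ≟ j)
  bundle⊆complete {h} {j} v∈ = ∈-subset⁺ (λ v → complete h v ≟ j) (bundle⇒complete v∈)

  complete-partition : ∀ {h} → Empty (free own) ⊎ Crossing G (Part (complete h) h) →
                       (∀ i → IsBundle G (_∈ bundle own i)) → IsPartition G (complete h)
  complete-partition {h} absorbs bundles j with j ≟ h | absorbs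
  ... | yes refl | inj₂ crossing = crossing⇒bundle G crossing
  ... | yes refl | inj₁ none     =
    bundle-resp G bundle⇒complete (complete⇒bundle λ v∈free _ → none (_ , v∈free)) (bundles j)
  ... | no  j≢h  | _             =
    bundle-resp G bundle⇒complete (complete⇒bundle λ _ h≡j → j≢h (sym h≡j)) (bundles j)

module Allocate {m n} (G : CompleteMultipartite m)
  (u : Fin (suc n) → Fin m → ℚ) (u≥0 : ∀ i v → 0ℚ ≤ u i v) (τ : Fin (suc n) → ℚ)
  (f : Fin (suc n) → Fin m → Fin (suc n)) (f-partition : ∀ k → IsPartition G (f k))
  (f-heavy : ∀ k → 0ℚ < τ k → ∀ j → τ k + τ k ≤ value (u k) (f k) j) where

  Agent : Set
  Agent = Fin (suc n)

  block : Agent → Agent → Subset m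
  block k j = subset (λ v → f k v ≟ j)

  module _ {k j : Agent} {v : Fin m} where

    ∈-block⁺ : f k v ≡ j → v ∈ block k j
    ∈-block⁺ = ∈-subset⁺ (λ w → f k w ≟ j)

    ∈-block⁻ : v ∈ block k j → f k v ≡ j
    ∈-block⁻ = ∈-subset⁻ (λ w → f k w ≟ j)

  block-bundle : ∀ k j → IsBundle G (_∈ block k j)
  block-bundle k j = bundle-resp G ∈-block⁺ ∈-block⁻ (f-partition k j)

  block-heavy : ∀ {k} → 0ℚ < τ k → ∀ j → τ k + τ k ≤ weight (u k) (block k j)
  block-heavy {k} 0<τ j = ≤-trans (f-heavy k 0<τ j) (≤-reflexive (value≡weight (u k) (f k) j))

  blocks-disjoint : ∀ {k j j′} → j ≢ j′ → Disjoint (block k j) (block k j′)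
  blocks-disjoint j≢j′ v∈j v∈j′ = j≢j′ (trans (sym (∈-block⁻ v∈j)) (∈-block⁻ v∈j′))

  Fair : Agent → Subset m → Set
  Fair i B = IsBundle G (_∈ B) × τ i ≤ weight (u i) B

  FairAllocation : Set
  FairAllocation = Σ (Allocation m (suc n)) λ own → ∀ i → Fair i (bundle own i)

  record Invariant (own : Allocation m (suc n)) (R : Subset (suc n)) : Set where
    field
      served   : ∀ {i} → i ∉ R → Fair i (bundle own i)
      waiting  : ∀ {i} → i ∈ R → bundle own i ≡ ⊥
      positive : ∀ {i} → i ∈ R → 0ℚ < τ i

  serve : ∀ {own R k B} → Invariant own R → k ∈ R → B ⊆ free own → Fair k B → Invariant (give B k own) (R - k)
  serve {own} {R} {k} {B} inv k∈R B⊆free fair = record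
    { served   = served′
    ; waiting  = λ i∈R-k → trans (bundle-give-other B⊆free (x∈p-y⇒x≢y R i∈R-k)) (waiting (p─q⊆p R ⁅ k ⁆ i∈R-k))
    ; positive = λ i∈R-k → positive (p─q⊆p R ⁅ k ⁆ i∈R-k)
    }
    where
    open Invariant inv
    served′ : ∀ {i} → i ∉ R - k → Fair i (bundle (give B k own) i)
    served′ {i} i∉R-k with i ≟ k
    ... | yes refl = subst (Fair i) (sym (bundle-give-self (waiting k∈R))) fair
    ... | no  i≢k  = subst (Fair i) (sym (bundle-give-other B⊆free i≢k))
                           (served λ i∈R → i∉R-k (x∈p∧x≢y⇒x∈p-y i∈R i≢k))

  finish : ∀ {own R} → Invariant own R → Empty R → FairAllocation
  finish {own} inv R-empty = own , λ i → Invariant.served inv λ i∈R → R-empty (i , i∈R)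

  SmallItems : Allocation m (suc n) → Subset (suc n) → Set
  SmallItems own R = ∀ {k} → k ∈ R → ∀ {v} → v ∈ free own → u k v < τ k

  IntactBlocks : Allocation m (suc n) → Subset (suc n) → Set
  IntactBlocks own R = ∀ {k} → k ∈ R →
    Σ (List Agent) λ js → Unique js × ∣ R ∣ ℕ.≤ length js × All (λ j → block k j ⊆ free own) js

  intact-weight : ∀ {own R} → Invariant own R → IntactBlocks own R →
                  ∀ {k} → k ∈ R → ∣ R ∣ · (τ k + τ k) ≤ weight (u k) (free own)
  intact-weight {own} {R} inv intact {k} k∈R with intact k∈R
  ... | js , unique , ∣R∣≤js , js-intact =
    subst (λ ℓ → ℓ · (τ k + τ k) ≤ weight (u k) (free own)) count
      (weight-⊇-disjoint (u≥0 k) (map (block k) chosen)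
        (AllPairs.map⁺ (AllPairs.map blocks-disjoint (Unique.take⁺ ∣ R ∣ unique)))
        (All.map⁺ (All.take⁺ ∣ R ∣ js-intact))
        (All.map⁺ (All.universal (block-heavy (Invariant.positive inv k∈R)) chosen)))
    where
    chosen : List Agent
    chosen = take ∣ R ∣ js
    count : length (map (block k) chosen) ≡ ∣ R ∣
    count = trans (length-map (block k) chosen) (length-take-≤ ∣R∣≤js)

  LargeItem : Allocation m (suc n) → Subset (suc n) → Set
  LargeItem own R = ∃₂ λ k v → k ∈ R × v ∈ free own × τ k ≤ u k v

  largeItem? : ∀ own R → Dec (LargeItem own R)
  largeItem? own R = any? λ k → any? λ v → (k ∈? R) ×-dec (v ∈? free own) ×-dec (τ k ≤? u k v)

  no-large⇒small : ∀ {own R} → ¬ LargeItem own R → SmallItems own R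
  no-large⇒small ¬large k∈R v∈free = ≰⇒> λ τ≤u → ¬large (_ , _ , k∈R , v∈free , τ≤u)

  -- The vertex v lies in only one block of each partition, so each agent loses at most one intact block.
  serveLargeItem : ∀ {own R k v} → Invariant own R → IntactBlocks own R → k ∈ R → v ∈ free own → τ k ≤ u k v →
                   Invariant (give ⁅ v ⁆ k own) (R - k) × IntactBlocks (give ⁅ v ⁆ k own) (R - k)
  serveLargeItem {own} {R} {k} {v} inv intact k∈R v∈free τ≤u = serve inv k∈R ⁅v⁆⊆free fair , intact′
    where
    ⁅v⁆⊆free : ⁅ v ⁆ ⊆ free own
    ⁅v⁆⊆free x∈⁅v⁆ = subst (_∈ free own) (sym (x∈⁅y⁆⇒x≡y v x∈⁅v⁆)) v∈free
    fair : Fair k ⁅ v ⁆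
    fair = subsingleton⇒bundle G (λ x∈ y∈ → trans (x∈⁅y⁆⇒x≡y v x∈) (sym (x∈⁅y⁆⇒x≡y v y∈)))
         , subst (τ k ≤_) (sym (weight-⁅⁆ (u k) v)) τ≤u
    intact′ : IntactBlocks (give ⁅ v ⁆ k own) (R - k)
    intact′ {k′} k′∈R-k with intact (p─q⊆p R ⁅ k ⁆ k′∈R-k)
    ... | js , unique , ∣R∣≤js , js-intact =
      filter ≢v js , Unique.filter⁺ ≢v unique ,
      x∈p∧∣p∣≤1+r⇒∣p-x∣≤r k∈R (ℕ.≤-trans ∣R∣≤js (length-filter-≢ _≟_ (f k′ v) unique)) ,
      All.zipWith still-intact (All.filter⁺ ≢v js-intact , All.all-filter ≢v js)
      where
      ≢v : ∀ j → Dec (j ≢ f k′ v)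
      ≢v j = ¬? (j ≟ f k′ v)
      still-intact : ∀ {j} → block k′ j ⊆ free own × j ≢ f k′ v → block k′ j ⊆ free (give ⁅ v ⁆ k own)
      still-intact (j⊆free , j≢) x∈j =
        free-give⁺ (j⊆free x∈j) λ x∈⁅v⁆ → j≢ (trans (sym (∈-block⁻ x∈j)) (cong (f k′) (x∈⁅y⁆⇒x≡y v x∈⁅v⁆)))

  record Seeding (own : Allocation m (suc n)) (R : Subset (suc n)) (seeds : List (Subset m)) : Set where
    field
      few        : ∣ R ∣ ℕ.≤ length seeds
      seeds-free : All (_⊆ free own) seeds
      disjoint   : AllPairs Disjoint seeds
      crossing   : All (λ s → Crossing G (_∈ s)) seeds
      light      : ∀ {k} → k ∈ R → All (λ s → weight (u k) s ≤ τ k + τ k) seeds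
      small      : SmallItems own R
      enough     : ∀ {k} → k ∈ R → length seeds · (τ k + τ k) ≤ weight (u k) (free own)

  plantSeeds : ∀ {own R k} → Invariant own R → IntactBlocks own R → SmallItems own R → k ∈ R → ∃ (Seeding own R)
  plantSeeds {own} {R} {k} inv intact small k∈R with intact k∈R
  ... | js , unique , ∣R∣≤js , js-intact = map seed chosen , record
    { few        = ℕ.≤-reflexive (sym count)
    ; seeds-free = All.map⁺ (All.map seed-free chosen-intact)
    ; disjoint   = AllPairs.map⁺ (AllPairs.map seeds-disjoint (Unique.take⁺ ∣ R ∣ unique))
    ; crossing   = All.map⁺ (All.map seed-crossing chosen-intact)
    ; light      = λ k′∈R → All.map⁺ (All.map (seed-light k′∈R) chosen-intact)
    ; small      = small
    ; enough     = λ k′∈R → subst (λ ℓ → ℓ · _ ≤ _) (sym count) (intact-weight inv intact k′∈R)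
    }
    where
    open Invariant inv
    seed : Agent → Subset m
    seed j = crossingPair G (block k j)
    chosen : List Agent
    chosen = take ∣ R ∣ js
    chosen-intact : All (λ j → block k j ⊆ free own) chosen
    chosen-intact = All.take⁺ ∣ R ∣ js-intact
    count : length (map seed chosen) ≡ ∣ R ∣
    count = trans (length-map seed chosen) (length-take-≤ ∣R∣≤js)
    seed-free : ∀ {j} → block k j ⊆ free own → seed j ⊆ free own
    seed-free j⊆free = ⊆-trans (crossingPair-⊆ G _) j⊆free
    seeds-disjoint : ∀ {j j′} → j ≢ j′ → Disjoint (seed j) (seed j′)
    seeds-disjoint j≢j′ x∈ x∈′ = blocks-disjoint j≢j′ (crossingPair-⊆ G _ x∈) (crossingPair-⊆ G _ x∈′)
    seed-crossing : ∀ {j} → block k j ⊆ free own → Crossing G (_∈ seed j)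
    seed-crossing {j} j⊆free = crossingPair-crossing G (block k j)
      (heavy-bundle-crossing G (u≥0 k) (block-bundle k j) (λ v∈j → small k∈R (j⊆free v∈j)) (positive k∈R)
        (≤-trans (p≤q+p (<⇒≤ (positive k∈R))) (block-heavy (positive k∈R) j)))
    seed-light : ∀ {k′} → k′ ∈ R → ∀ {j} → block k j ⊆ free own → weight (u k′) (seed j) ≤ τ k′ + τ k′
    seed-light k′∈R j⊆free =
      crossingPair-weight G _ (u≥0 _) (<⇒≤ (positive k′∈R)) λ v∈j → <⇒≤ (small k′∈R (j⊆free v∈j))

  module _ {own R s rest} (inv : Invariant own R) (seeding : Seeding own R (s ∷ rest)) where
    open Invariant inv
    open Seeding seeding

    room : Subset m
    room = free own ─ ⋃ rest

    room⊆free : room ⊆ free own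
    room⊆free = p─q⊆p (free own) (⋃ rest)

    seed⊆room : s ⊆ room
    seed⊆room x∈s = x∈p∧x∉q⇒x∈p─q (All.head seeds-free x∈s) (disjoint-⋃ (AllPairs.head disjoint) x∈s)

    -- Each other seed is worth at most 2τ k, so the room keeps the 2τ k counted for the first seed.
    room-claimed : ∀ {k} → k ∈ R → τ k ≤ weight (u k) room
    room-claimed {k} k∈R = ≤-trans (p≤q+p (<⇒≤ (positive k∈R)))
      (≤-cancelʳ-+ (≤-trans (enough k∈R) (weight-cover (u≥0 k) room (⋃ rest) free⊆room∪rest))
                   (weight-⋃ (u≥0 k) rest (All.tail (light k∈R))))
      where
      free⊆room∪rest : free own ⊆ room ∪ ⋃ rest
      free⊆room∪rest {x} x∈free with x ∈? ⋃ rest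
      ... | yes x∈rest = x∈p∪q⁺ (inj₂ x∈rest)
      ... | no  x∉rest = x∈p∪q⁺ (inj₁ (x∈p∧x∉q⇒x∈p─q x∈free x∉rest))

    reseed : ∀ {B k₀} → B ⊆ room → (∀ {k} → k ∈ R → weight (u k) B ≤ τ k + τ k) → k₀ ∈ R →
             Seeding (give B k₀ own) (R - k₀) rest
    reseed {B} {k₀} B⊆room B-light k₀∈R = record
      { few        = x∈p∧∣p∣≤1+r⇒∣p-x∣≤r k₀∈R few
      ; seeds-free = All.zipWith rest-free (All.tail seeds-free , ⊆-⋃ rest)
      ; disjoint   = AllPairs.tail disjoint
      ; crossing   = All.tail crossing
      ; light      = All.tail ∘ light ∘ p─q⊆p R ⁅ k₀ ⁆
      ; small      = λ k∈R′ v∈free′ → small (p─q⊆p R ⁅ k₀ ⁆ k∈R′) (proj₁ (free-give⁻ v∈free′))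
      ; enough     = λ k∈R′ → let k∈R = p─q⊆p R ⁅ k₀ ⁆ k∈R′ in
          ≤-cancelˡ-+ (≤-trans (enough k∈R) (weight-cover (u≥0 _) B (free (give B k₀ own)) free⊆B∪free′))
                      (B-light k∈R)
      }
      where
      rest-free : ∀ {t} → t ⊆ free own × t ⊆ ⋃ rest → t ⊆ free (give B k₀ own)
      rest-free (t⊆free , t⊆rest) x∈t =
        free-give⁺ (t⊆free x∈t) λ x∈B → x∈p─q⇒x∉q (free own) (⋃ rest) (B⊆room x∈B) (t⊆rest x∈t)
      free⊆B∪free′ : free own ⊆ B ∪ free (give B k₀ own)
      free⊆B∪free′ {x} x∈free with x ∈? B
      ... | yes x∈B = x∈p∪q⁺ (inj₁ x∈B)
      ... | no  x∉B = x∈p∪q⁺ (inj₂ (free-give⁺ x∈free x∉B))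

    serveSeed : ∀ {k} → k ∈ R → ∃₂ λ own′ R′ → Invariant own′ R′ × Seeding own′ R′ rest
    serveSeed {k} k∈R =
      let B , s⊆B , B⊆room , B-light , k₀ , k₀∈R , τ≤B =
            fillBag seed⊆room (All.head ∘ light) (k , k∈R , room-claimed k∈R)
          fair = crossing⇒bundle G (crossing-⊆ G s⊆B (All.head crossing)) , τ≤B
      in give B k₀ own , R - k₀ , serve inv k₀∈R (⊆-trans B⊆room room⊆free) fair , reseed B⊆room B-light k₀∈R
      where open BagFilling u u≥0 τ R room (λ k∈R v∈room → <⇒≤ (small k∈R (room⊆free v∈room)))

  bagFillingPhase : ∀ seeds {own R} → Invariant own R → Seeding own R seeds → FairAllocation
  bagFillingPhase []         inv seeding = finish inv (∣p∣≤0⇒Empty (Seeding.few seeding))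
  bagFillingPhase (s ∷ rest) {R = R} inv seeding with nonempty? R
  ... | no  R-empty   = finish inv R-empty
  ... | yes (k , k∈R) =
    let _ , _ , inv′ , seeding′ = serveSeed inv seeding k∈R
    in bagFillingPhase rest inv′ seeding′

  largeItemPhase : ∀ r {own R} → ∣ R ∣ ℕ.≤ r → Invariant own R → IntactBlocks own R → FairAllocation
  largeItemPhase ℕ.zero  ∣R∣≤0 inv _ = finish inv (∣p∣≤0⇒Empty ∣R∣≤0)
  largeItemPhase (suc r) {own} {R} ∣R∣≤1+r inv intact with largeItem? own R
  ... | yes (k , v , k∈R , v∈free , τ≤u) =
    let inv′ , intact′ = serveLargeItem inv intact k∈R v∈free τ≤u
    in largeItemPhase r (x∈p∧∣p∣≤1+r⇒∣p-x∣≤r k∈R ∣R∣≤1+r) inv′ intact′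
  ... | no ¬large with nonempty? R
  ...   | no  R-empty   = finish inv R-empty
  ...   | yes (k , k∈R) =
    let seeds , seeding = plantSeeds inv intact (no-large⇒small {own} {R} ¬large) k∈R
    in bagFillingPhase seeds inv seeding

  waiting₀ : Subset (suc n)
  waiting₀ = subset (λ k → 0ℚ <? τ k)

  own₀ : Allocation m (suc n)
  own₀ _ = nothing

  bundle₀ : ∀ i → bundle own₀ i ≡ ⊥
  bundle₀ i = Empty-unique {p = bundle own₀ i} λ (v , v∈) → just≢nothing (sym (∈-bundle⁻ own₀ {i = i} v∈))

  invariant₀ : Invariant own₀ waiting₀
  invariant₀ = record
    { served   = λ {i} i∉R₀ → subst (Fair i) (sym (bundle₀ i))
                   ( subsingleton⇒bundle G (λ v∈⊥ → ⊥-elim (∉⊥ v∈⊥))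
                   , subst (τ i ≤_) (sym (weight-⊥ (u i)))
                           (≮⇒≥ λ 0<τ → i∉R₀ (∈-subset⁺ (λ k → 0ℚ <? τ k) 0<τ)))
    ; waiting  = λ {i} _ → bundle₀ i
    ; positive = ∈-subset⁻ (λ k → 0ℚ <? τ k)
    }

  intact₀ : IntactBlocks own₀ waiting₀
  intact₀ _ = allFin (suc n) , Unique.allFin⁺ (suc n) ,
              subst (∣ waiting₀ ∣ ℕ.≤_) (sym (length-tabulate id)) (∣p∣≤n waiting₀) ,
              All.universal (λ _ {_} _ → ∈-free⁺ own₀ refl) (allFin (suc n))

  allocate : Σ (Fin m → Agent) λ A → IsPartition G A × ∀ i → τ i ≤ value (u i) A i
  allocate =
    let own , fair  = largeItemPhase (suc n) (∣p∣≤n waiting₀) invariant₀ intact₀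
        h , absorbs = absorber G own
    in complete G own h , complete-partition G own absorbs (proj₁ ∘ fair) , λ i →
       ≤-trans (proj₂ (fair i)) (≤-trans (weight-mono (u≥0 i) (bundle⊆complete G own))
                                         (≤-reflexive (sym (value≡weight (u i) (complete G own h) i))))

quarter-sum : ∀ x → (½ * ½ * x + ½ * ½ * x) + (½ * ½ * x + ½ * ½ * x) ≡ x
quarter-sum x = begin
  (½ * ½ * x + ½ * ½ * x) + (½ * ½ * x + ½ * ½ * x) ≡⟨ cong₂ _+_ (sym (*-distribʳ-+ x (½ * ½) (½ * ½)))
                                                              (sym (*-distribʳ-+ x (½ * ½) (½ * ½))) ⟩
  ½ * x + ½ * x                                     ≡⟨ sym (*-distribʳ-+ x ½ ½) ⟩
  1ℚ * x                                            ≡⟨ *-identityˡ x ⟩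
  x                                                 ∎
  where open ≡-Reasoning

theorem3 : ∀ {m : ℕ} (G : CompleteMultipartite m) (n' : ℕ)
    (u : Fin (suc n') → Fin m → ℚ) → (∀ i v → 0ℚ ≤ℚ u i v)
    → (μ : Fin (suc n') → ℚ) → (∀ i → IsMMS G n' (u i) (μ i))
    → Σ (Fin m → Fin (suc n')) λ A → IsPartition G A
      × (∀ i → (½ * ½) * μ i ≤ℚ value (u i) A i)
theorem3 G n' u u≥0 μ mms = Allocate.allocate G u u≥0 (λ i → ½ * ½ * μ i) mmsPartition
  (λ k → proj₁ (proj₂ (proj₁ (mms k)))) twoQuarters≤block
  where
  mmsPartition : Fin (suc n') → Fin _ → Fin (suc n')
  mmsPartition k = proj₁ (proj₁ (mms k))
  twoQuarters≤block : ∀ k → 0ℚ < ½ * ½ * μ k → ∀ j → ½ * ½ * μ k + ½ * ½ * μ k ≤ value (u k) (mmsPartition k) j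
  twoQuarters≤block k 0<τ j = begin
    ½ * ½ * μ k + ½ * ½ * μ k                                 ≤⟨ p≤q+p (<⇒≤ (+-mono-< 0<τ 0<τ)) ⟩
    (½ * ½ * μ k + ½ * ½ * μ k) + (½ * ½ * μ k + ½ * ½ * μ k) ≡⟨ quarter-sum (μ k) ⟩
    μ k                                                       ≡⟨ sym (proj₂ (proj₂ (proj₁ (mms k)))) ⟩
    minValue (u k) (mmsPartition k)                           ≤⟨ minFin-≤ n' _ j ⟩
    value (u k) (mmsPartition k) j                            ∎
    where open ≤-Reasoning
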